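{- Let $G_1,\dots,G_k$ be finite simple graphs and $V=V(G_1)\times\cdots\times V(G_k)$. Then $(G_1\square\cdots\square G_k)_\delta$ is the graph with vertex set $V$ and edge set $E((G_1)_\delta\square\cdots\square(G_k)_\delta)\cup S$, where $S$ is the set of all pairs $uv$ with $u=(u_1,\dots,u_k)$, $v=(v_1,\dots,v_k)\in V$ such that $u_i\neq v_i$ for at least two indices $i$ and $d_{G_1\square\cdots\square G_k}(u)=d_{G_1\square\cdots\square G_k}(v)$.
   Context: All graphs are finite and simple; $d_G(x)$ denotes the degree of $x$ in $G$. The $\delta$-complement $G_\delta$ of a graph $G$ is the graph on $V(G)$ in which distinct $u,v$ are adjacent iff either ($d_G(u)=d_G(v)$ and $uv\notin E(G)$) or ($d_G(u)\neq d_G(v)$ and $uv\in E(G)$). The Cartesian product $G_1\square\cdots\square G_k$ has vertex set $V(G_1)\times\cdots\times V(G_k)$, with $(u_1,\dots,u_k)$ adjacent to $(v_1,\dots,v_k)$ iff there is exactly one index $i$ with $u_i\neq v_i$, and for that index $u_iv_i\in E(G_i)$. -}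

module Defs where

open import Data.Bool using (Bool; true; false; _∧_; _∨_; not; if_then_else_)
open import Data.Nat using (ℕ; zero; suc; _≡ᵇ_)
open import Data.List using (List; []; _∷_; [_]; map; concatMap; length; filterᵇ)
open import Data.List.Membership.Propositional using (_∈_)
open import Data.List.Relation.Unary.Unique.Propositional using (Unique)
open import Data.List.Relation.Unary.All using (All; []; _∷_)
open import Data.Product using (_×_; _,_)
open import Data.Unit using (⊤; tt)
open import Relation.Binary.Definitions using (DecidableEquality)
open import Relation.Binary.PropositionalEquality using (_≡_)
open import Relation.Nullary using (does; yes; no)
import Data.Product.Properties as ×P

record Graph (V : Set) : Set where
  field
    _≟_   : DecidableEquality V
    verts : List V
    adj   : V → V → Bool
open Graph public

IsFiniteSimple : {V : Set} → Graph V → Set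
IsFiniteSimple {V} G =
  (∀ v → v ∈ verts G) × Unique (verts G) ×
  (∀ u v → adj G u v ≡ adj G v u) × (∀ v → adj G v v ≡ false)

deg : {V : Set} → Graph V → V → ℕ
deg G v = length (filterᵇ (adj G v) (verts G))

δc : {V : Set} → Graph V → Graph V
δc G = record
  { _≟_ = _≟_ G
  ; verts = verts G
  ; adj = λ u v → if does (_≟_ G u v) then false
                   else (if deg G u ≡ᵇ deg G v then not (adj G u v) else adj G u v)
  }

Tuple : List Set → Set
Tuple [] = ⊤
Tuple (V ∷ Vs) = V × Tuple Vs

AllSimple : {Vs : List Set} → All Graph Vs → Set
AllSimple [] = ⊤
AllSimple (G ∷ Gs) = IsFiniteSimple G × AllSimple Gs

mapδ : {Vs : List Set} → All Graph Vs → All Graph Vs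
mapδ [] = []
mapδ (G ∷ Gs) = δc G ∷ mapδ Gs

tupleEq : {Vs : List Set} → All Graph Vs → DecidableEquality (Tuple Vs)
tupleEq [] tt tt = yes Relation.Binary.PropositionalEquality.refl
tupleEq (G ∷ Gs) = ×P.≡-dec (_≟_ G) (tupleEq Gs)

allTuples : {Vs : List Set} → All Graph Vs → List (Tuple Vs)
allTuples [] = [ tt ]
allTuples (G ∷ Gs) = concatMap (λ a → map (a ,_) (allTuples Gs)) (verts G)

prodAdj : {Vs : List Set} → All Graph Vs → Tuple Vs → Tuple Vs → Bool
prodAdj [] tt tt = false
prodAdj (G ∷ Gs) (a , u) (b , v) =
  (adj G a b ∧ does (tupleEq Gs u v)) ∨ (does (_≟_ G a b) ∧ prodAdj Gs u v)

□ : {Vs : List Set} → All Graph Vs → Graph (Tuple Vs)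
□ Gs = record { _≟_ = tupleEq Gs ; verts = allTuples Gs ; adj = prodAdj Gs }

diffCount : {Vs : List Set} → All Graph Vs → Tuple Vs → Tuple Vs → ℕ
diffCount [] tt tt = 0
diffCount (G ∷ Gs) (a , u) (b , v) =
  (if does (_≟_ G a b) then 0 else 1) Data.Nat.+ diffCount Gs u v

-- Because every factor is irreflexive and each vertex list enumerates its graph exactly
-- once, degrees add up in a Cartesian product: d(a , u) = d_G(a) + d(u). So if u and v
-- differ only in coordinate i, then d(u) = d(v) iff d_{G_i}(u_i) = d_{G_i}(v_i), and the
-- δ-complement of the product agrees on {u , v} with the product of the δ-complements.
-- Pairs differing in at least two coordinates are adjacent in neither product, hence
-- adjacent in the δ-complement of the product exactly when their degrees agree.
module Submission where

open import Defs
open import Data.Bool using (Bool; true; false; _∧_; not; if_then_else_)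
open import Data.Bool.Properties using (∨-identityʳ; ∧-identityʳ; ∧-zeroʳ; T-≡)
open import Data.Empty using (⊥-elim)
open import Data.List using (List; []; _∷_; _++_; map; concatMap; length; filterᵇ)
open import Data.List.Membership.Propositional using (_∈_)
open import Data.List.Properties using (map-cong; map-cong-local)
open import Data.List.Relation.Unary.All as All using (All; []; _∷_)
open import Data.List.Relation.Unary.AllPairs using (_∷_)
open import Data.List.Relation.Unary.Any using (here; there)
open import Data.List.Relation.Unary.Unique.Propositional using (Unique)
open import Data.Nat using (ℕ; zero; suc; _+_; _≡ᵇ_; _≤_; z≤n; s≤s)
open import Data.Nat.ListAction using (sum)
open import Data.Nat.Properties
  using (+-comm; +-assoc; 1+n≢0; suc-injective; ≤-refl; ≤-trans; n≤1+n; ≡ᵇ⇒≡; ≡⇒≡ᵇ; +-commutativeSemigroup)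
open import Algebra.Properties.CommutativeSemigroup +-commutativeSemigroup using (x∙yz≈y∙xz)
open import Data.Product using (_×_; _,_; proj₁; proj₂)
open import Data.Sum using (_⊎_; inj₁; inj₂; [_,_])
open import Data.Unit using (⊤; tt)
open import Function using (_∘_; _⇔_; mk⇔; Equivalence)
open import Relation.Binary.Definitions using (DecidableEquality)
open import Relation.Binary.PropositionalEquality
  using (_≡_; _≢_; ≢-sym; subst; _≗_; refl; sym; trans; cong; cong₂; module ≡-Reasoning)
open import Relation.Nullary using (does; yes; no; contradiction)
open import Relation.Nullary.Decidable using (dec-true; dec-false; toSum)

open ≡-Reasoning

variable
  A B V : Set
  Vs : List Set

+-cancelˡ-≡ᵇ : (m x y : ℕ) → (m + x ≡ᵇ m + y) ≡ (x ≡ᵇ y)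
+-cancelˡ-≡ᵇ zero    x y = refl
+-cancelˡ-≡ᵇ (suc m) x y = +-cancelˡ-≡ᵇ m x y

+-cancelʳ-≡ᵇ : (m x y : ℕ) → (x + m ≡ᵇ y + m) ≡ (x ≡ᵇ y)
+-cancelʳ-≡ᵇ m x y rewrite +-comm x m | +-comm y m = +-cancelˡ-≡ᵇ m x y

notIf : Bool → Bool → Bool
notIf c x = if c then not x else x

notIf-false : (c : Bool) → notIf c false ≡ c
notIf-false true  = refl
notIf-false false = refl

≡ᵇ≡true⇔≡ : (m n : ℕ) → ((m ≡ᵇ n) ≡ true) ⇔ (m ≡ n)
≡ᵇ≡true⇔≡ m n = mk⇔ (≡ᵇ⇒≡ m n ∘ Equivalence.from T-≡) (Equivalence.to T-≡ ∘ ≡⇒≡ᵇ m n)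

iverson : Bool → ℕ
iverson true  = 1
iverson false = 0

count : (A → Bool) → List A → ℕ
count p xs = length (filterᵇ p xs)

count-∷ : (p : A → Bool) (x : A) (xs : List A) → count p (x ∷ xs) ≡ iverson (p x) + count p xs
count-∷ p x xs with p x
... | true  = refl
... | false = refl

count≡sum-iverson : (p : A → Bool) (xs : List A) → count p xs ≡ sum (map (iverson ∘ p) xs)
count≡sum-iverson p []       = refl
count≡sum-iverson p (x ∷ xs) =
  trans (count-∷ p x xs) (cong (iverson (p x) +_) (count≡sum-iverson p xs))

count-cong : {p q : A → Bool} → p ≗ q → count p ≗ count q
count-cong p≗q []       = refl
count-cong {p = p} {q} p≗q (x ∷ xs) = begin
  count p (x ∷ xs)             ≡⟨ count-∷ p x xs ⟩
  iverson (p x) + count p xs   ≡⟨ cong₂ _+_ (cong iverson (p≗q x)) (count-cong p≗q xs) ⟩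
  iverson (q x) + count q xs   ≡⟨ count-∷ q x xs ⟨
  count q (x ∷ xs)             ∎

count-false : (xs : List A) → count (λ _ → false) xs ≡ 0
count-false []       = refl
count-false (x ∷ xs) = count-false xs

count-map : (p : B → Bool) (f : A → B) (xs : List A) → count p (map f xs) ≡ count (p ∘ f) xs
count-map p f []       = refl
count-map p f (x ∷ xs) = begin
  count p (f x ∷ map f xs)             ≡⟨ count-∷ p (f x) (map f xs) ⟩
  iverson (p (f x)) + count p (map f xs) ≡⟨ cong (iverson (p (f x)) +_) (count-map p f xs) ⟩
  iverson (p (f x)) + count (p ∘ f) xs ≡⟨ count-∷ (p ∘ f) x xs ⟨
  count (p ∘ f) (x ∷ xs)               ∎

count-++ : (p : A → Bool) (xs ys : List A) → count p (xs ++ ys) ≡ count p xs + count p ys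
count-++ p []       ys = refl
count-++ p (x ∷ xs) ys = begin
  count p (x ∷ xs ++ ys)                     ≡⟨ count-∷ p x (xs ++ ys) ⟩
  iverson (p x) + count p (xs ++ ys)         ≡⟨ cong (iverson (p x) +_) (count-++ p xs ys) ⟩
  iverson (p x) + (count p xs + count p ys)  ≡⟨ +-assoc (iverson (p x)) _ _ ⟨
  (iverson (p x) + count p xs) + count p ys  ≡⟨ cong (_+ count p ys) (count-∷ p x xs) ⟨
  count p (x ∷ xs) + count p ys              ∎

count-concatMap : (p : B → Bool) (f : A → List B) (xs : List A) →
  count p (concatMap f xs) ≡ sum (map (count p ∘ f) xs)
count-concatMap p f []       = refl
count-concatMap p f (x ∷ xs) =
  trans (count-++ p (f x) (concatMap f xs)) (cong (count p (f x) +_) (count-concatMap p f xs))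

module _ (_≟_ : DecidableEquality A) (a : A) (f : A → ℕ) (D : ℕ) where

  pointUpdate : A → ℕ
  pointUpdate b = if does (a ≟ b) then D else f b

  pointUpdate-self : pointUpdate a ≡ D
  pointUpdate-self = cong (λ c → if c then D else f a) (dec-true (a ≟ a) refl)

  pointUpdate-≢ : {b : A} → a ≢ b → pointUpdate b ≡ f b
  pointUpdate-≢ {b} a≢b = cong (λ c → if c then D else f b) (dec-false (a ≟ b) a≢b)

  sum-pointUpdate-∉ : {xs : List A} → All (a ≢_) xs → sum (map pointUpdate xs) ≡ sum (map f xs)
  sum-pointUpdate-∉ a∉xs = cong sum (map-cong-local (All.map pointUpdate-≢ a∉xs))

  sum-pointUpdate-∈ : {xs : List A} → Unique xs → a ∈ xs → f a ≡ 0 →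
    sum (map pointUpdate xs) ≡ D + sum (map f xs)
  sum-pointUpdate-∈ {x ∷ xs} (x∉xs ∷ _) (here refl) fa≡0 = begin
    pointUpdate a + sum (map pointUpdate xs)
      ≡⟨ cong₂ _+_ pointUpdate-self (sum-pointUpdate-∉ x∉xs) ⟩
    D + sum (map f xs)
      ≡⟨ cong (λ n → D + (n + sum (map f xs))) fa≡0 ⟨
    D + (f a + sum (map f xs)) ∎
  sum-pointUpdate-∈ {x ∷ xs} (x∉xs ∷ unique) (there a∈xs) fa≡0 = begin
    pointUpdate x + sum (map pointUpdate xs)
      ≡⟨ cong₂ _+_ (pointUpdate-≢ (≢-sym (All.lookup x∉xs a∈xs)))
                   (sum-pointUpdate-∈ unique a∈xs fa≡0) ⟩
    f x + (D + sum (map f xs))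
      ≡⟨ x∙yz≈y∙xz (f x) D _ ⟩
    D + (f x + sum (map f xs)) ∎

Irreflexive : Graph V → Set
Irreflexive G = ∀ v → adj G v v ≡ false

δc-irreflexive : (G : Graph V) → Irreflexive (δc G)
δc-irreflexive G v rewrite dec-true (_≟_ G v v) refl = refl

irreflexive⇒¬loop : (H : Graph V) → Irreflexive H → (v : V) → adj H v v ≢ true
irreflexive⇒¬loop H irr v loop with () ← trans (sym (irr v)) loop

AllIrreflexive : All Graph Vs → Set
AllIrreflexive []       = ⊤
AllIrreflexive (G ∷ Gs) = Irreflexive G × AllIrreflexive Gs

simple⇒irreflexive : (Gs : All Graph Vs) → AllSimple Gs → AllIrreflexive Gs
simple⇒irreflexive []       tt                          = tt
simple⇒irreflexive (G ∷ Gs) ((_ , _ , _ , irr) , simple) = irr , simple⇒irreflexive Gs simple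

mapδ-irreflexive : (Gs : All Graph Vs) → AllIrreflexive (mapδ Gs)
mapδ-irreflexive []       = tt
mapδ-irreflexive (G ∷ Gs) = δc-irreflexive G , mapδ-irreflexive Gs

δc-adj-≢ : (G : Graph V) {u v : V} → u ≢ v →
  adj (δc G) u v ≡ notIf (deg G u ≡ᵇ deg G v) (adj G u v)
δc-adj-≢ G {u} {v} u≢v rewrite dec-false (_≟_ G u v) u≢v = refl

module _ (G : Graph V) (Gs : All Graph Vs) where

  prodAdj-sameHead : Irreflexive G → (a : V) (u v : Tuple Vs) →
    prodAdj (G ∷ Gs) (a , u) (a , v) ≡ prodAdj Gs u v
  prodAdj-sameHead irr a u v rewrite irr a | dec-true (_≟_ G a a) refl = refl

  prodAdj-differentHead : {a b : V} → a ≢ b → (u v : Tuple Vs) →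
    prodAdj (G ∷ Gs) (a , u) (b , v) ≡ adj G a b ∧ does (tupleEq Gs u v)
  prodAdj-differentHead {a} {b} a≢b u v rewrite dec-false (_≟_ G a b) a≢b = ∨-identityʳ _

  prodAdj-differentHead-sameTail : {a b : V} → a ≢ b → (u : Tuple Vs) →
    prodAdj (G ∷ Gs) (a , u) (b , u) ≡ adj G a b
  prodAdj-differentHead-sameTail {a} {b} a≢b u rewrite prodAdj-differentHead a≢b u u
    | dec-true (tupleEq Gs u u) refl = ∧-identityʳ (adj G a b)

  prodAdj-differentHead⇒sameTail : {a b : V} → a ≢ b → (u v : Tuple Vs) →
    prodAdj (G ∷ Gs) (a , u) (b , v) ≡ true → u ≡ v
  prodAdj-differentHead⇒sameTail {a} a≢b u v adjacent
    with tupleEq Gs u v | trans (sym (prodAdj-differentHead a≢b u v)) adjacent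
  ... | yes u≡v | _           = u≡v
  ... | no _    | headAdjacent with () ← trans (sym (∧-zeroʳ (adj G a _))) headAdjacent

  diffCount-sameHead : (a : V) (u v : Tuple Vs) →
    diffCount (G ∷ Gs) (a , u) (a , v) ≡ diffCount Gs u v
  diffCount-sameHead a u v rewrite dec-true (_≟_ G a a) refl = refl

  diffCount-differentHead : {a b : V} → a ≢ b → (u v : Tuple Vs) →
    diffCount (G ∷ Gs) (a , u) (b , v) ≡ suc (diffCount Gs u v)
  diffCount-differentHead {a} {b} a≢b u v rewrite dec-false (_≟_ G a b) a≢b = refl

diffCount-refl : (Gs : All Graph Vs) (u : Tuple Vs) → diffCount Gs u u ≡ 0
diffCount-refl []       tt      = refl
diffCount-refl (G ∷ Gs) (a , u) = trans (diffCount-sameHead G Gs a u u) (diffCount-refl Gs u)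

diffCount≡0⇒≡ : (Gs : All Graph Vs) (u v : Tuple Vs) → diffCount Gs u v ≡ 0 → u ≡ v
diffCount≡0⇒≡ []       tt      tt      _    = refl
diffCount≡0⇒≡ (G ∷ Gs) (a , u) (b , v) none with toSum (_≟_ G a b)
... | inj₁ refl =
  cong (a ,_) (diffCount≡0⇒≡ Gs u v (trans (sym (diffCount-sameHead G Gs a u v)) none))
... | inj₂ a≢b  = ⊥-elim (1+n≢0 (trans (sym (diffCount-differentHead G Gs a≢b u v)) none))

diffCount-mapδ : (Gs : All Graph Vs) (u v : Tuple Vs) → diffCount (mapδ Gs) u v ≡ diffCount Gs u v
diffCount-mapδ []       tt      tt      = refl
diffCount-mapδ (G ∷ Gs) (a , u) (b , v) = cong (_ +_) (diffCount-mapδ Gs u v)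

prodAdj⇒diffCount≡1 : (Gs : All Graph Vs) → AllIrreflexive Gs → (u v : Tuple Vs) →
  prodAdj Gs u v ≡ true → diffCount Gs u v ≡ 1
prodAdj⇒diffCount≡1 (G ∷ Gs) (irr , irrs) (a , u) (b , v) adjacent with toSum (_≟_ G a b)
... | inj₁ refl = trans (diffCount-sameHead G Gs a u v)
  (prodAdj⇒diffCount≡1 Gs irrs u v (trans (sym (prodAdj-sameHead G Gs irr a u v)) adjacent))
... | inj₂ a≢b with refl ← prodAdj-differentHead⇒sameTail G Gs a≢b u v adjacent =
  trans (diffCount-differentHead G Gs a≢b u u) (cong suc (diffCount-refl Gs u))

diffCount-pos⇒≢ : (Gs : All Graph Vs) (u v : Tuple Vs) → 1 ≤ diffCount Gs u v → u ≢ v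
diffCount-pos⇒≢ Gs u _ apart refl with () ← subst (1 ≤_) (diffCount-refl Gs u) apart

diffCount≥2⇒prodAdj≡false : (Gs : All Graph Vs) → AllIrreflexive Gs → (u v : Tuple Vs) →
  2 ≤ diffCount Gs u v → prodAdj Gs u v ≡ false
diffCount≥2⇒prodAdj≡false Gs irr u v far with prodAdj Gs u v in adjacent
... | false = refl
... | true  with s≤s () ← subst (2 ≤_) (prodAdj⇒diffCount≡1 Gs irr u v adjacent) far

□-irreflexive : (Gs : All Graph Vs) → AllIrreflexive Gs → Irreflexive (□ Gs)
□-irreflexive Gs irr u with prodAdj Gs u u in loop
... | false = refl
... | true  with () ← trans (sym (diffCount-refl Gs u)) (prodAdj⇒diffCount≡1 Gs irr u u loop)

count-allTuples-∷ : (G : Graph V) (Gs : All Graph Vs) (p : Tuple (V ∷ Vs) → Bool) →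
  count p (allTuples (G ∷ Gs))
    ≡ sum (map (λ b → count (λ w → p (b , w)) (allTuples Gs)) (verts G))
count-allTuples-∷ G Gs p = trans (count-concatMap p (λ b → map (b ,_) (allTuples Gs)) (verts G))
  (cong sum (map-cong (λ b → count-map p (b ,_) (allTuples Gs)) (verts G)))

does-tupleEq-∷ : (G : Graph V) (Gs : All Graph Vs) (a b : V) (u w : Tuple Vs) →
  does (tupleEq (G ∷ Gs) (a , u) (b , w)) ≡ does (_≟_ G a b) ∧ does (tupleEq Gs u w)
does-tupleEq-∷ G Gs a b u w with _≟_ G a b
... | yes refl = refl
... | no _     = refl

count-allTuples-≟ : (Gs : All Graph Vs) → AllSimple Gs → (u : Tuple Vs) →
  count (λ w → does (tupleEq Gs u w)) (allTuples Gs) ≡ 1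
count-allTuples-≟ []       tt tt = refl
count-allTuples-≟ {V ∷ Vs} (G ∷ Gs) ((complete , unique , _) , simple) (a , u) = begin
  count (λ w → does (tupleEq (G ∷ Gs) (a , u) w)) (allTuples (G ∷ Gs))
    ≡⟨ count-allTuples-∷ G Gs _ ⟩
  sum (map (λ b → count (λ w → does (tupleEq (G ∷ Gs) (a , u) (b , w))) (allTuples Gs)) (verts G))
    ≡⟨ cong sum (map-cong layer (verts G)) ⟩
  sum (map (pointUpdate (_≟_ G) a (λ _ → 0) 1) (verts G))
    ≡⟨ sum-pointUpdate-∈ (_≟_ G) a (λ _ → 0) 1 unique (complete a) refl ⟩
  1 + sum (map (λ _ → 0) (verts G))
    ≡⟨ cong suc (count≡sum-iverson (λ _ → false) (verts G)) ⟨
  1 + count (λ _ → false) (verts G)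
    ≡⟨ cong suc (count-false (verts G)) ⟩
  1 ∎
  where
  layer : (b : V) → count (λ w → does (tupleEq (G ∷ Gs) (a , u) (b , w))) (allTuples Gs)
                  ≡ pointUpdate (_≟_ G) a (λ _ → 0) 1 b
  layer b rewrite count-cong (does-tupleEq-∷ G Gs a b u) (allTuples Gs) with _≟_ G a b
  ... | yes refl = count-allTuples-≟ Gs simple u
  ... | no _     = count-false (allTuples Gs)

deg-□-∷ : (G : Graph V) (Gs : All Graph Vs) → IsFiniteSimple G → AllSimple Gs →
  (a : V) (u : Tuple Vs) → deg (□ (G ∷ Gs)) (a , u) ≡ deg G a + deg (□ Gs) u
deg-□-∷ {V} G Gs (complete , unique , _ , irreflexive) simple a u = begin
  count (prodAdj (G ∷ Gs) (a , u)) (allTuples (G ∷ Gs))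
    ≡⟨ count-allTuples-∷ G Gs _ ⟩
  sum (map (λ b → count (λ w → prodAdj (G ∷ Gs) (a , u) (b , w)) (allTuples Gs)) (verts G))
    ≡⟨ cong sum (map-cong layer (verts G)) ⟩
  sum (map (pointUpdate (_≟_ G) a (iverson ∘ adj G a) D) (verts G))
    ≡⟨ sum-pointUpdate-∈ (_≟_ G) a (iverson ∘ adj G a) D unique (complete a)
                         (cong iverson (irreflexive a)) ⟩
  D + sum (map (iverson ∘ adj G a) (verts G))
    ≡⟨ cong (D +_) (count≡sum-iverson (adj G a) (verts G)) ⟨
  D + deg G a
    ≡⟨ +-comm D (deg G a) ⟩
  deg G a + D ∎
  where
  D = deg (□ Gs) u
  -- Neighbours of (a , u) with first coordinate b: those of u if b = a, otherwise (b , u) iff a ~ b.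
  layer : (b : V) → count (λ w → prodAdj (G ∷ Gs) (a , u) (b , w)) (allTuples Gs)
                  ≡ pointUpdate (_≟_ G) a (iverson ∘ adj G a) D b
  layer b with _≟_ G a b
  ... | yes refl rewrite irreflexive a = refl
  ... | no _ with adj G a b
  ...   | true  = trans (count-cong (λ _ → ∨-identityʳ _) (allTuples Gs))
                        (count-allTuples-≟ Gs simple u)
  ...   | false = count-false (allTuples Gs)

prodAdj-mapδ : (Gs : All Graph Vs) → AllSimple Gs → (u v : Tuple Vs) → diffCount Gs u v ≡ 1 →
  prodAdj (mapδ Gs) u v ≡ notIf (deg (□ Gs) u ≡ᵇ deg (□ Gs) v) (prodAdj Gs u v)
prodAdj-mapδ (G ∷ Gs) (simpleG@(_ , _ , _ , irr) , simple) (a , u) (b , v) one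
  rewrite deg-□-∷ G Gs simpleG simple a u | deg-□-∷ G Gs simpleG simple b v
  with toSum (_≟_ G a b)
... | inj₁ refl = begin
  prodAdj (mapδ (G ∷ Gs)) (a , u) (a , v)
    ≡⟨ prodAdj-sameHead (δc G) (mapδ Gs) (δc-irreflexive G) a u v ⟩
  prodAdj (mapδ Gs) u v
    ≡⟨ prodAdj-mapδ Gs simple u v (trans (sym (diffCount-sameHead G Gs a u v)) one) ⟩
  notIf (deg (□ Gs) u ≡ᵇ deg (□ Gs) v) (prodAdj Gs u v)
    ≡⟨ cong₂ notIf (+-cancelˡ-≡ᵇ (deg G a) _ _) (prodAdj-sameHead G Gs irr a u v) ⟨
  notIf (deg G a + deg (□ Gs) u ≡ᵇ deg G a + deg (□ Gs) v) (prodAdj (G ∷ Gs) (a , u) (a , v)) ∎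
... | inj₂ a≢b
  with refl ← diffCount≡0⇒≡ Gs u v
                (suc-injective (trans (sym (diffCount-differentHead G Gs a≢b u v)) one)) = begin
  prodAdj (mapδ (G ∷ Gs)) (a , u) (b , u)
    ≡⟨ prodAdj-differentHead-sameTail (δc G) (mapδ Gs) a≢b u ⟩
  adj (δc G) a b
    ≡⟨ δc-adj-≢ G a≢b ⟩
  notIf (deg G a ≡ᵇ deg G b) (adj G a b)
    ≡⟨ cong₂ notIf (+-cancelʳ-≡ᵇ (deg (□ Gs) u) (deg G a) (deg G b))
                   (prodAdj-differentHead-sameTail G Gs a≢b u) ⟨
  notIf (deg G a + deg (□ Gs) u ≡ᵇ deg G b + deg (□ Gs) u) (prodAdj (G ∷ Gs) (a , u) (b , u)) ∎

δc□-adj-near : (Gs : All Graph Vs) → AllSimple Gs → (u v : Tuple Vs) →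
  diffCount Gs u v ≡ 1 → adj (δc (□ Gs)) u v ≡ adj (□ (mapδ Gs)) u v
δc□-adj-near Gs simple u v one =
  trans (δc-adj-≢ (□ Gs) (diffCount-pos⇒≢ Gs u v (subst (1 ≤_) (sym one) ≤-refl)))
        (sym (prodAdj-mapδ Gs simple u v one))

δc□-adj-far : (Gs : All Graph Vs) → AllSimple Gs → (u v : Tuple Vs) → 2 ≤ diffCount Gs u v →
  adj (δc (□ Gs)) u v ≡ (deg (□ Gs) u ≡ᵇ deg (□ Gs) v)
δc□-adj-far Gs simple u v far = begin
  adj (δc (□ Gs)) u v
    ≡⟨ δc-adj-≢ (□ Gs) (diffCount-pos⇒≢ Gs u v (≤-trans (n≤1+n 1) far)) ⟩
  notIf (deg (□ Gs) u ≡ᵇ deg (□ Gs) v) (prodAdj Gs u v)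
    ≡⟨ cong (notIf _) (diffCount≥2⇒prodAdj≡false Gs (simple⇒irreflexive Gs simple) u v far) ⟩
  notIf (deg (□ Gs) u ≡ᵇ deg (□ Gs) v) false
    ≡⟨ notIf-false _ ⟩
  (deg (□ Gs) u ≡ᵇ deg (□ Gs) v) ∎

□δc-adj-far : (Gs : All Graph Vs) (u v : Tuple Vs) → 2 ≤ diffCount Gs u v →
  adj (□ (mapδ Gs)) u v ≡ false
□δc-adj-far Gs u v far =
  diffCount≥2⇒prodAdj≡false (mapδ Gs) (mapδ-irreflexive Gs) u v
    (subst (2 ≤_) (sym (diffCount-mapδ Gs u v)) far)

mainTheorem3 : (Vs : List Set) (Gs : All Graph Vs) → AllSimple Gs →
    (u v : Tuple Vs) →
    (adj (δc (□ Gs)) u v ≡ true)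
      ⇔ ((adj (□ (mapδ Gs)) u v ≡ true)
         ⊎ ((2 ≤ diffCount Gs u v) × (deg (□ Gs) u ≡ deg (□ Gs) v)))
mainTheorem3 Vs Gs simple u v with diffCount Gs u v in differ
... | zero with refl ← diffCount≡0⇒≡ Gs u v differ = mk⇔
  (⊥-elim ∘ irreflexive⇒¬loop (δc (□ Gs)) (δc-irreflexive (□ Gs)) u)
  [ ⊥-elim ∘ irreflexive⇒¬loop (□ (mapδ Gs)) (□-irreflexive (mapδ Gs) (mapδ-irreflexive Gs)) u
  , (λ ()) ∘ proj₁ ]
... | suc zero = mk⇔ (inj₁ ∘ trans (sym near)) [ trans near , (λ { (s≤s ()) }) ∘ proj₁ ]
  where
  near : adj (δc (□ Gs)) u v ≡ adj (□ (mapδ Gs)) u v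
  near = δc□-adj-near Gs simple u v differ
... | suc (suc _) = mk⇔
  (λ adjacent → inj₂ (s≤s (s≤s z≤n) , Equivalence.to (≡ᵇ≡true⇔≡ _ _) (trans (sym far) adjacent)))
  [ (λ adjacentδ → contradiction (trans (sym farδ) adjacentδ) λ ())
  , trans far ∘ Equivalence.from (≡ᵇ≡true⇔≡ _ _) ∘ proj₂ ]
  where
  apart : 2 ≤ diffCount Gs u v
  apart = subst (2 ≤_) (sym differ) (s≤s (s≤s z≤n))
  far : adj (δc (□ Gs)) u v ≡ (deg (□ Gs) u ≡ᵇ deg (□ Gs) v)
  far = δc□-adj-far Gs simple u v apart
  farδ : adj (□ (mapδ Gs)) u v ≡ false
  farδ = □δc-adj-far Gs u v apart
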